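{- Let $b\geq 2$ and $k\in\mathbb{Z}^+$. If there exists a $k$-oasis base $b$, then there exists a $k$-mirage base $b$.
   Context: For integers $c\geq 0$ and $b\geq 2$, the augmented generalized happy function $S_{[c,b]}:\mathbb{Z}^+\to\mathbb{Z}^+$ is defined by $S_{[c,b]}\left(\sum_{i=0}^n a_i b^i\right)=c+\sum_{i=0}^n a_i^2$, where $0\le a_i\le b-1$, $a_n\neq 0$ (the base $b$ expansion); additionally $S_{[0,b]}(0)=0$. A positive integer $a$ is a fixed point of $S_{[c,b]}$ if $S_{[c,b]}(a)=a$. A $k$-oasis base $b$ is a set of $k$ consecutive non-negative integers $c$ such that for each of them $S_{[c,b]}$ has at least one fixed point. A $k$-mirage base $b$ is a set of $k$ consecutive integers $\{d_1,\dots,d_k\}$ such that for each $1\le i\le k$, $d_i=r_i-S_{[0,b]}(r_i)$ for some non-negative integer $r_i$ having at most three base $b$ digits (i.e., $0\le r_i<b^3$). -}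

module Defs where

open import Data.Nat using (ℕ; zero; suc; _+_; _*_; _^_; _<_; _≤_; NonZero)
open import Data.Nat.DivMod using (_/_; _%_)
open import Data.Integer as ℤ using (ℤ; +_)
open import Data.Product using (Σ; ∃; _×_; _,_)
open import Relation.Binary.PropositionalEquality using (_≡_)

-- Sum of squares of base-b digits of n, computed with fuel.
-- Fuel f ≥ n suffices whenever b ≥ 2 (each step strictly decreases n > 0).
digitSqSumFuel : (b : ℕ) → .{{NonZero b}} → ℕ → ℕ → ℕ
digitSqSumFuel b zero    n = 0
digitSqSumFuel b (suc f) zero = 0
digitSqSumFuel b (suc f) n@(suc _) = (n % b) * (n % b) + digitSqSumFuel b f (n / b)

digitSqSum : (b : ℕ) → .{{NonZero b}} → ℕ → ℕ
digitSqSum b n = digitSqSumFuel b n n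

S : (c b : ℕ) → .{{NonZero b}} → ℕ → ℕ
S c b a = c + digitSqSum b a

HasFixedPoint : (c b : ℕ) → .{{NonZero b}} → Set
HasFixedPoint c b = ∃ λ a → 0 < a × S c b a ≡ a

IsOasis : (k b : ℕ) → .{{NonZero b}} → ℕ → Set
IsOasis k b c₀ = ∀ i → i < k → HasFixedPoint (c₀ + i) b

IsMirage : (k b : ℕ) → .{{NonZero b}} → ℤ → Set
IsMirage k b d₀ = ∀ i → i < k →
  ∃ λ r → r < b ^ 3 × d₀ ℤ.+ (+ i) ≡ (+ r) ℤ.- (+ S 0 b r)

{-# OPTIONS --safe #-}
-- Write D = S_[0,b] and ψ n = n - D n, so that a is a fixed point of S_[c,b] iff ψ a = c.
-- Splitting a = r + h b³ with r < b³ gives ψ a = ψ r + (h b³ - D h). Since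
-- D (h + 1) ≤ D h + 2b - 3, the second summand grows by at least b³ - 2b + 3 with h,
-- whereas ψ varies by at most b³ - 2b + 1 on [0, b³). Hence the fixed points for
-- consecutive c share the same h, and d₀ = c₀ + D h - h b³ starts a mirage whose
-- witnesses are the low blocks r.
module Submission where

open import Defs
open import Data.Nat using (ℕ; _≤_; NonZero)
open import Data.Integer using (ℤ)
open import Data.Product using (∃)

open import Data.Nat using (zero; suc; _+_; _*_; _^_; _<_; z≤n; s≤s; s≤s⁻¹; z<s)
open import Data.Nat.Properties
open import Data.Nat.DivMod
open import Data.Nat.Divisibility using (n∣m*n)
open import Data.Nat.Induction using (<-rec)
open import Data.Nat.Tactic.RingSolver using (solve-∀)
open import Data.Product using (_,_; proj₁; proj₂)
open import Data.Sum using (inj₁; inj₂)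
open import Data.Empty using (⊥-elim)
open import Relation.Binary.Definitions using (tri<; tri≈; tri>)
open import Relation.Binary.PropositionalEquality

open import Data.Integer as ℤ using ()
open import Data.Integer.Properties using (pos-+)
import Data.Integer.Tactic.RingSolver as ℤSolver

n≤n*n : ∀ n → n ≤ n * n
n≤n*n zero    = z≤n
n≤n*n (suc n) = m≤m*n (suc n) (suc n)

m≤n⇒m*m+n≤m+n*n : ∀ {m n} → m ≤ n → m * m + n ≤ m + n * n
m≤n⇒m*m+n≤m+n*n {m} m≤n with m≤n⇒∃[o]m+o≡n m≤n
... | t , refl = begin
  m * m + (m + t)             ≡⟨ regroup m t ⟩
  m + m * m + t               ≤⟨ +-monoʳ-≤ (m + m * m) (n≤n*n t) ⟩
  m + m * m + t * t           ≤⟨ m≤m+n _ (2 * m * t) ⟩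
  m + m * m + t * t + 2 * m * t ≡⟨ square m t ⟩
  m + (m + t) * (m + t)       ∎
  where
  open ≤-Reasoning
  regroup : ∀ m t → m * m + (m + t) ≡ m + m * m + t
  regroup = solve-∀
  square : ∀ m t → m + m * m + t * t + 2 * m * t ≡ m + (m + t) * (m + t)
  square = solve-∀

-- x ↦ x (o - x) is increasing as long as x ≤ o / 2.
m≤n⇒m*o+n*n≤m*m+n*o : ∀ {m n o} → m ≤ n → n + m ≤ o → m * o + n * n ≤ m * m + n * o
m≤n⇒m*o+n*n≤m*m+n*o {m} {o = o} m≤n n+m≤o with m≤n⇒∃[o]m+o≡n m≤n
... | t , refl = begin
  m * o + (m + t) * (m + t)         ≡⟨ expand m t o ⟩
  m * m + m * o + t * (m + t + m)   ≤⟨ +-monoʳ-≤ (m * m + m * o) (*-monoʳ-≤ t n+m≤o) ⟩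
  m * m + m * o + t * o             ≡⟨ collect m t o ⟩
  m * m + (m + t) * o               ∎
  where
  open ≤-Reasoning
  expand : ∀ m t o → m * o + (m + t) * (m + t) ≡ m * m + m * o + t * (m + t + m)
  expand = solve-∀
  collect : ∀ m t o → m * m + m * o + t * o ≡ m * m + (m + t) * o
  collect = solve-∀

digit-square-≤ : ∀ b {d} → d < b → d * d + 3 * b ≤ d + b * b + 2
digit-square-≤ (suc p) {d} (s≤s d≤p) = begin
  d * d + 3 * suc p       ≡⟨ shift d p ⟩
  (d * d + p) + (2 * p + 3) ≤⟨ +-monoˡ-≤ (2 * p + 3) (m≤n⇒m*m+n≤m+n*n d≤p) ⟩
  (d + p * p) + (2 * p + 3) ≡⟨ unshift d p ⟩
  d + suc p * suc p + 2   ∎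
  where
  open ≤-Reasoning
  shift : ∀ d p → d * d + 3 * suc p ≡ (d * d + p) + (2 * p + 3)
  shift = solve-∀
  unshift : ∀ d p → (d + p * p) + (2 * p + 3) ≡ d + suc p * suc p + 2
  unshift = solve-∀

threeDigits-square-≥ : ∀ b {x y z} → x < b → y < b → z < b →
  z + (y + x * b) * b + b * b + 1 ≤ b ^ 3 + b + (z * z + (y * y + x * x))
threeDigits-square-≥ (suc p) {x} {y} {z} (s≤s x≤p) (s≤s y≤p) (s≤s z≤p) =
  +-cancelʳ-≤ (p * p) _ _ (begin
    z + (y + x * b) * b + b * b + 1 + p * p       ≡⟨ expand x y z p ⟩
    z + y * b + (x * (b * b) + p * p) + (b * b + 1)
      ≤⟨ +-monoˡ-≤ (b * b + 1) (+-mono-≤ (+-mono-≤ (n≤n*n z) (*-monoˡ-≤ b y≤p)) top-digit) ⟩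
    z * z + p * b + (x * x + p * (b * b)) + (b * b + 1)
      ≤⟨ m≤m+n _ (y * y) ⟩
    z * z + p * b + (x * x + p * (b * b)) + (b * b + 1) + y * y ≡⟨ collect x y z p ⟩
    b ^ 3 + b + (z * z + (y * y + x * x)) + p * p ∎)
  where
  open ≤-Reasoning
  b = suc p
  top-digit : x * (b * b) + p * p ≤ x * x + p * (b * b)
  top-digit = m≤n⇒m*o+n*n≤m*m+n*o x≤p (m≤n⇒m≤1+n (+-monoʳ-≤ p (≤-trans x≤p (m≤m*n p b))))
  expand : ∀ x y z p → z + (y + x * suc p) * suc p + suc p * suc p + 1 + p * p
                     ≡ z + y * suc p + (x * (suc p * suc p) + p * p) + (suc p * suc p + 1)
  expand = solve-∀
  collect : ∀ x y z p → z * z + p * suc p + (x * x + p * (suc p * suc p)) + (suc p * suc p + 1) + y * y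
                      ≡ suc p * (suc p * (suc p * 1)) + suc p + (z * z + (y * y + x * x)) + p * p
  collect = solve-∀

module _ where
  -- Opened locally: unqualified, ℤ's prefix +_ makes ℕ sections like (x +_) ambiguous.
  open Data.Integer using (+_)

  [+m-+n]++i≡+r-+s : ∀ m n i r s → m + i + s ≡ n + r → (+ m ℤ.- + n) ℤ.+ + i ≡ + r ℤ.- + s
  [+m-+n]++i≡+r-+s m n i r s eq = begin
    (+ m ℤ.- + n) ℤ.+ + i              ≡⟨ addSubtract (+ m) (+ n) (+ i) (+ s) ⟩
    (+ m ℤ.+ + i ℤ.+ + s) ℤ.- + n ℤ.- + s ≡⟨ cong (λ x → x ℤ.- + n ℤ.- + s) (pos-+[m+i+s]) ⟨
    + (m + i + s) ℤ.- + n ℤ.- + s       ≡⟨ cong (λ x → + x ℤ.- + n ℤ.- + s) eq ⟩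
    + (n + r) ℤ.- + n ℤ.- + s           ≡⟨ cong (λ x → x ℤ.- + n ℤ.- + s) (pos-+ n r) ⟩
    (+ n ℤ.+ + r) ℤ.- + n ℤ.- + s       ≡⟨ cancel (+ n) (+ r) (+ s) ⟩
    + r ℤ.- + s                         ∎
    where
    open ≡-Reasoning
    pos-+[m+i+s] : + (m + i + s) ≡ + m ℤ.+ + i ℤ.+ + s
    pos-+[m+i+s] = trans (pos-+ (m + i) s) (cong (ℤ._+ + s) (pos-+ m i))
    addSubtract : ∀ m n i s → (m ℤ.- n) ℤ.+ i ≡ (m ℤ.+ i ℤ.+ s) ℤ.- n ℤ.- s
    addSubtract = ℤSolver.solve-∀
    cancel : ∀ n r s → (n ℤ.+ r) ℤ.- n ℤ.- s ≡ r ℤ.- s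
    cancel = ℤSolver.solve-∀

module _ (b : ℕ) .{{_ : NonZero b}} (1<b : 1 < b) where

  private
    D : ℕ → ℕ
    D = digitSqSum b

  digitSqSumFuel-irrelevant : ∀ f g n → n ≤ f → n ≤ g →
                              digitSqSumFuel b f n ≡ digitSqSumFuel b g n
  digitSqSumFuel-irrelevant zero    zero    zero _ _ = refl
  digitSqSumFuel-irrelevant zero    (suc g) zero _ _ = refl
  digitSqSumFuel-irrelevant (suc f) zero    zero _ _ = refl
  digitSqSumFuel-irrelevant (suc f) (suc g) zero _ _ = refl
  digitSqSumFuel-irrelevant (suc f) (suc g) n@(suc m) (s≤s m≤f) (s≤s m≤g) =
    cong (n % b * (n % b) +_)
      (digitSqSumFuel-irrelevant f g (n / b) (≤-trans n/b≤m m≤f) (≤-trans n/b≤m m≤g))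
    where
    n/b≤m : n / b ≤ m
    n/b≤m = s≤s⁻¹ (m/n<m n b 1<b)

  digitSqSum-divMod : ∀ n → D n ≡ n % b * (n % b) + D (n / b)
  digitSqSum-divMod zero =
    sym (cong₂ (λ r s → r * r + D s) (m<n⇒m%n≡m (<-trans z<s 1<b)) (0/n≡0 b))
  digitSqSum-divMod n@(suc m) =
    cong (n % b * (n % b) +_)
      (digitSqSumFuel-irrelevant m (n / b) (n / b) (s≤s⁻¹ (m/n<m n b 1<b)) ≤-refl)

  digitSqSum[d+q*b] : ∀ {d} q → d < b → D (d + q * b) ≡ d * d + D q
  digitSqSum[d+q*b] {d} q d<b = begin
    D n                          ≡⟨ digitSqSum-divMod n ⟩
    n % b * (n % b) + D (n / b)  ≡⟨ cong₂ (λ r s → r * r + D s) n%b≡d n/b≡q ⟩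
    d * d + D q                  ∎
    where
    open ≡-Reasoning
    n = d + q * b
    n%b≡d : n % b ≡ d
    n%b≡d = trans ([m+kn]%n≡m%n d q b) (m<n⇒m%n≡m d<b)
    n/b≡q : n / b ≡ q
    n/b≡q = trans (+-distrib-/-∣ʳ d (n∣m*n q)) (cong₂ _+_ (m<n⇒m/n≡0 d<b) (m*n/n≡m q b))

  digitSqSum-digit : ∀ {d} → d < b → D d ≡ d * d
  digitSqSum-digit {d} d<b =
    trans (cong D (sym (+-identityʳ d))) (trans (digitSqSum[d+q*b] 0 d<b) (+-identityʳ (d * d)))

  digitSqSum[r+h*b^k] : ∀ k {r} h → r < b ^ k → D (r + h * b ^ k) ≡ D r + D h
  digitSqSum[r+h*b^k] zero    {zero} h _ = cong D (*-identityʳ h)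
  digitSqSum[r+h*b^k] zero    {suc r} h (s≤s ())
  digitSqSum[r+h*b^k] (suc k) {r}    h r<b^[1+k] = begin
    D (r + h * b ^ suc k)            ≡⟨ cong D regroup ⟩
    D (d + (q + h * b ^ k) * b)      ≡⟨ digitSqSum[d+q*b] (q + h * b ^ k) (m%n<n r b) ⟩
    d * d + D (q + h * b ^ k)        ≡⟨ cong (d * d +_) (digitSqSum[r+h*b^k] k h q<b^k) ⟩
    d * d + (D q + D h)              ≡⟨ +-assoc (d * d) (D q) (D h) ⟨
    d * d + D q + D h                ≡⟨ cong (_+ D h) (digitSqSum-divMod r) ⟨
    D r + D h                        ∎
    where
    open ≡-Reasoning
    d = r % b
    q = r / b
    q<b^k : q < b ^ k
    q<b^k = m<n*o⇒m/o<n (subst (r <_) (*-comm b (b ^ k)) r<b^[1+k])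
    shift : ∀ d q h c b → d + q * b + h * (b * c) ≡ d + (q + h * c) * b
    shift = solve-∀
    regroup : r + h * b ^ suc k ≡ d + (q + h * b ^ k) * b
    regroup = trans (cong (_+ h * b ^ suc k) (m≡m%n+[m/n]*n r b)) (shift d q h (b ^ k) b)

  digitSqSumFuel≤n*b : ∀ f n → digitSqSumFuel b f n ≤ n * b
  digitSqSumFuel≤n*b zero    n          = z≤n
  digitSqSumFuel≤n*b (suc f) zero       = z≤n
  digitSqSumFuel≤n*b (suc f) n@(suc _)  = begin
    d * d + digitSqSumFuel b f q  ≤⟨ +-mono-≤ (*-monoʳ-≤ d (<⇒≤ (m%n<n n b))) (digitSqSumFuel≤n*b f q) ⟩
    d * b + q * b                 ≤⟨ +-monoʳ-≤ (d * b) (*-monoˡ-≤ b (m≤m*n q b)) ⟩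
    d * b + q * b * b             ≡⟨ *-distribʳ-+ b d (q * b) ⟨
    (d + q * b) * b               ≡⟨ cong (_* b) (m≡m%n+[m/n]*n n b) ⟨
    n * b                         ∎
    where
    open ≤-Reasoning
    d = n % b
    q = n / b

  digitSqSum-boundedAbove : ∀ n → D n + 3 * b ≤ n + b * b + 2
  digitSqSum-boundedAbove n = begin
    D n + 3 * b                  ≡⟨ cong (_+ 3 * b) (digitSqSum-divMod n) ⟩
    d * d + D q + 3 * b          ≤⟨ +-monoˡ-≤ (3 * b) (+-monoʳ-≤ (d * d) (digitSqSumFuel≤n*b q q)) ⟩
    d * d + q * b + 3 * b        ≡⟨ swap (d * d) (q * b) (3 * b) ⟩
    (d * d + 3 * b) + q * b      ≤⟨ +-monoˡ-≤ (q * b) (digit-square-≤ b (m%n<n n b)) ⟩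
    (d + b * b + 2) + q * b      ≡⟨ regroup d (b * b) (q * b) ⟩
    (d + q * b) + b * b + 2      ≡⟨ cong (λ m → m + b * b + 2) (m≡m%n+[m/n]*n n b) ⟨
    n + b * b + 2                ∎
    where
    open ≤-Reasoning
    d = n % b
    q = n / b
    swap : ∀ x y z → x + y + z ≡ (x + z) + y
    swap = solve-∀
    regroup : ∀ d c y → (d + c + 2) + y ≡ (d + y) + c + 2
    regroup = solve-∀

  digitSqSum-boundedBelow : ∀ {n} → n < b ^ 3 → n + b * b + 1 ≤ b ^ 3 + b + D n
  digitSqSum-boundedBelow {n} n<b^3 = begin
    n + b * b + 1                          ≡⟨ cong (λ m → m + b * b + 1) digits ⟩
    z + (y + x * b) * b + b * b + 1        ≤⟨ threeDigits-square-≥ b x<b (m%n<n q b) (m%n<n n b) ⟩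
    b ^ 3 + b + (z * z + (y * y + x * x))  ≡⟨ cong (b ^ 3 + b +_) digitSquares ⟨
    b ^ 3 + b + D n                        ∎
    where
    open ≤-Reasoning
    z = n % b
    q = n / b
    y = q % b
    x = q / b
    x<b : x < b
    x<b = m<n*o⇒m/o<n (m<n*o⇒m/o<n (subst (n <_) (cube b) n<b^3))
      where cube : ∀ b → b * (b * (b * 1)) ≡ b * b * b
            cube = solve-∀
    digits : n ≡ z + (y + x * b) * b
    digits = trans (m≡m%n+[m/n]*n n b) (cong (λ m → z + m * b) (m≡m%n+[m/n]*n q b))
    digitSquares : D n ≡ z * z + (y * y + x * x)
    digitSquares = begin-equality
      D n                    ≡⟨ digitSqSum-divMod n ⟩
      z * z + D q            ≡⟨ cong (z * z +_) (digitSqSum-divMod q) ⟩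
      z * z + (y * y + D x)  ≡⟨ cong (λ m → z * z + (y * y + m)) (digitSqSum-digit x<b) ⟩
      z * z + (y * y + x * x) ∎

  threeDigits-spread : ∀ {r r'} → r < b ^ 3 → r' < b ^ 3 →
                       r + D r' + 2 * b ≤ b ^ 3 + 1 + r' + D r
  threeDigits-spread {r} {r'} r<b^3 r'<b^3 = +-cancelʳ-≤ (b * b + 1 + b) _ _ (begin
    r + D r' + 2 * b + (b * b + 1 + b)        ≡⟨ split r (D r') b ⟩
    (r + b * b + 1) + (D r' + 3 * b)          ≤⟨ +-mono-≤ (digitSqSum-boundedBelow r<b^3) (digitSqSum-boundedAbove r') ⟩
    (b ^ 3 + b + D r) + (r' + b * b + 2)      ≡⟨ merge (b ^ 3) b (D r) r' ⟩
    b ^ 3 + 1 + r' + D r + (b * b + 1 + b)    ∎)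
    where
    open ≤-Reasoning
    split : ∀ r s b → r + s + 2 * b + (b * b + 1 + b) ≡ (r + b * b + 1) + (s + 3 * b)
    split = solve-∀
    merge : ∀ B b s r → (B + b + s) + (r + b * b + 2) ≡ B + 1 + r + s + (b * b + 1 + b)
    merge = solve-∀

  digitSqSum-suc : ∀ n → D (suc n) + 3 ≤ D n + 2 * b
  digitSqSum-suc = <-rec _ step
    where
    open ≤-Reasoning
    step : ∀ n → (∀ {m} → m < n → D (suc m) + 3 ≤ D m + 2 * b) → D (suc n) + 3 ≤ D n + 2 * b
    step n rec with m≤n⇒m<n∨m≡n (m%n<n n b)
    ... | inj₁ 1+d<b = begin
      D (suc n) + 3                ≡⟨ cong (λ m → D (suc m) + 3) (m≡m%n+[m/n]*n n b) ⟩
      D (suc d + q * b) + 3        ≡⟨ cong (_+ 3) (digitSqSum[d+q*b] q 1+d<b) ⟩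
      suc d * suc d + D q + 3      ≡⟨ square-suc d (D q) ⟩
      d * d + D q + 2 * suc (suc d) ≤⟨ +-monoʳ-≤ (d * d + D q) (*-monoʳ-≤ 2 1+d<b) ⟩
      d * d + D q + 2 * b          ≡⟨ cong (_+ 2 * b) (digitSqSum-divMod n) ⟨
      D n + 2 * b                  ∎
      where
      d = n % b
      q = n / b
      square-suc : ∀ d s → suc d * suc d + s + 3 ≡ d * d + s + 2 * suc (suc d)
      square-suc = solve-∀
    ... | inj₂ 1+d≡b = begin
      D (suc n) + 3                ≡⟨ cong (λ m → D m + 3) n+1≡[q+1]*b ⟩
      D (suc q * b) + 3            ≡⟨ cong (_+ 3) (digitSqSum[d+q*b] (suc q) (<-trans z<s 1<b)) ⟩
      D (suc q) + 3                ≤⟨ rec q<n ⟩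
      D q + 2 * b                  ≤⟨ +-monoˡ-≤ (2 * b) (m≤n+m (D q) (d * d)) ⟩
      d * d + D q + 2 * b          ≡⟨ cong (_+ 2 * b) (digitSqSum-divMod n) ⟨
      D n + 2 * b                  ∎
      where
      d = n % b
      q = n / b
      n+1≡[q+1]*b : suc n ≡ suc q * b
      n+1≡[q+1]*b = trans (cong suc (m≡m%n+[m/n]*n n b)) (cong (_+ q * b) 1+d≡b)
      q<n : q < n
      q<n = subst (q <_) (sym (m≡m%n+[m/n]*n n b))
              (<-≤-trans (m<n+m q (s≤s⁻¹ (subst (1 <_) (sym 1+d≡b) 1<b))) (+-monoʳ-≤ d (m≤m*n q b)))

  digitSqSum-gap : ∀ {m h h'} → 2 * b ≤ m + 3 → h < h' →
                   D h' + h * m + m + 3 ≤ D h + h' * m + 2 * b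
  digitSqSum-gap {m} {h} {suc h'} 2b≤m+3 (s≤s h≤h') with m≤n⇒m<n∨m≡n h≤h'
  ... | inj₂ refl = begin
    D (suc h) + h * m + m + 3      ≡⟨ regroup (D (suc h)) (h * m) m ⟩
    (D (suc h) + 3) + (h * m + m)  ≤⟨ +-monoˡ-≤ (h * m + m) (digitSqSum-suc h) ⟩
    (D h + 2 * b) + (h * m + m)    ≡⟨ collect (D h) (2 * b) (h * m) m ⟩
    D h + suc h * m + 2 * b        ∎
    where
    open ≤-Reasoning
    regroup : ∀ s t m → s + t + m + 3 ≡ (s + 3) + (t + m)
    regroup = solve-∀
    collect : ∀ s c t m → (s + c) + (t + m) ≡ s + (m + t) + c
    collect = solve-∀
  ... | inj₁ h<h' = begin
    D (suc h') + h * m + m + 3         ≤⟨ +-monoˡ-≤ 3 (+-monoˡ-≤ m (+-monoˡ-≤ (h * m) D[h'+1]≤D[h']+m)) ⟩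
    (D h' + m) + h * m + m + 3         ≡⟨ regroup (D h') m (h * m) ⟩
    (D h' + h * m + m + 3) + m         ≤⟨ +-monoˡ-≤ m (digitSqSum-gap 2b≤m+3 h<h') ⟩
    (D h + h' * m + 2 * b) + m         ≡⟨ collect (D h) (h' * m) (2 * b) m ⟩
    D h + suc h' * m + 2 * b           ∎
    where
    open ≤-Reasoning
    D[h'+1]≤D[h']+m : D (suc h') ≤ D h' + m
    D[h'+1]≤D[h']+m = +-cancelʳ-≤ 3 _ _ (begin
      D (suc h') + 3  ≤⟨ digitSqSum-suc h' ⟩
      D h' + 2 * b    ≤⟨ +-monoʳ-≤ (D h') 2b≤m+3 ⟩
      D h' + (m + 3)  ≡⟨ +-assoc (D h') m 3 ⟨
      D h' + m + 3    ∎)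
    regroup : ∀ s m t → (s + m) + t + m + 3 ≡ (s + t + m + 3) + m
    regroup = solve-∀
    collect : ∀ s t c m → (s + t + c) + m ≡ s + (m + t) + c
    collect = solve-∀

  private
    instance
      b^3-nonZero : NonZero (b ^ 3)
      b^3-nonZero = m^n≢0 b 3

  2b≤b^3+3 : 2 * b ≤ b ^ 3 + 3
  2b≤b^3+3 = begin
    2 * b        ≤⟨ *-monoˡ-≤ b 1<b ⟩
    b * b        ≤⟨ *-monoʳ-≤ b (m≤m*n b b) ⟩
    b * (b * b)  ≡⟨ cong (λ m → b * (b * m)) (*-identityʳ b) ⟨
    b ^ 3        ≤⟨ m≤m+n (b ^ 3) 3 ⟩
    b ^ 3 + 3    ∎
    where open ≤-Reasoning

  digitSqSum-block : ∀ a → D a ≡ D (a % b ^ 3) + D (a / b ^ 3)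
  digitSqSum-block a = trans (cong D (m≡m%n+[m/n]*n a (b ^ 3)))
                             (digitSqSum[r+h*b^k] 3 (a / b ^ 3) (m%n<n a (b ^ 3)))

  excess-gap : ∀ {a a'} → a / b ^ 3 < a' / b ^ 3 → a + D a' + 2 ≤ a' + D a
  excess-gap {a} {a'} h<h' = +-cancelʳ-≤ (B + 1 + 2 * b) _ _ (begin
    a + D a' + 2 + (B + 1 + 2 * b)
      ≡⟨ cong₂ (λ x y → x + y + 2 + (B + 1 + 2 * b)) (m≡m%n+[m/n]*n a B) (digitSqSum-block a') ⟩
    (r + h * B) + (D r' + D h') + 2 + (B + 1 + 2 * b)
      ≡⟨ regroup r h B (D r') (D h') b ⟩
    (D h' + h * B + B + 3) + (r + D r' + 2 * b)
      ≤⟨ +-mono-≤ (digitSqSum-gap 2b≤b^3+3 h<h') (threeDigits-spread (m%n<n a B) (m%n<n a' B)) ⟩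
    (D h + h' * B + 2 * b) + (B + 1 + r' + D r)
      ≡⟨ collect r' h' B (D r) (D h) b ⟩
    (r' + h' * B) + (D r + D h) + (B + 1 + 2 * b)
      ≡⟨ cong₂ (λ x y → x + y + (B + 1 + 2 * b)) (m≡m%n+[m/n]*n a' B) (digitSqSum-block a) ⟨
    a' + D a + (B + 1 + 2 * b) ∎)
    where
    open ≤-Reasoning
    B = b ^ 3
    r = a % B
    h = a / B
    r' = a' % B
    h' = a' / B
    regroup : ∀ r h B s t b → (r + h * B) + (s + t) + 2 + (B + 1 + 2 * b)
                            ≡ (t + h * B + B + 3) + (r + s + 2 * b)
    regroup = solve-∀
    collect : ∀ r h B s t b → (t + h * B + 2 * b) + (B + 1 + r + s)
                            ≡ (r + h * B) + (s + t) + (B + 1 + 2 * b)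
    collect = solve-∀

  consecutiveFixedPoints-excess : ∀ {c a a'} → c + D a ≡ a → suc c + D a' ≡ a' →
                                  a' + D a ≡ suc (a + D a')
  consecutiveFixedPoints-excess {c} {a} {a'} fix fix' = begin
    a' + D a               ≡⟨ cong (_+ D a) fix' ⟨
    suc c + D a' + D a     ≡⟨ cong suc (swap c (D a') (D a)) ⟩
    suc (c + D a + D a')   ≡⟨ cong (λ x → suc (x + D a')) fix ⟩
    suc (a + D a')         ∎
    where
    open ≡-Reasoning
    swap : ∀ x y z → x + y + z ≡ x + z + y
    swap = solve-∀

  consecutiveFixedPoints-sameBlock : ∀ {c a a'} → c + D a ≡ a → suc c + D a' ≡ a' →
                                     a / b ^ 3 ≡ a' / b ^ 3
  consecutiveFixedPoints-sameBlock {c} {a} {a'} fix fix' with <-cmp (a / b ^ 3) (a' / b ^ 3)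
  ... | tri≈ _ h≡h' _ = h≡h'
  ... | tri< h<h' _ _ = ⊥-elim (≤⇒≯ (excess-gap h<h') (begin-strict
    a' + D a        ≡⟨ consecutiveFixedPoints-excess fix fix' ⟩
    suc (a + D a')  <⟨ ≤-reflexive (+-comm 2 (a + D a')) ⟩
    a + D a' + 2    ∎))
    where open ≤-Reasoning
  ... | tri> _ _ h'<h = ⊥-elim (≤⇒≯ (excess-gap h'<h) (begin-strict
    a + D a'        <⟨ n<1+n (a + D a') ⟩
    suc (a + D a')  ≡⟨ consecutiveFixedPoints-excess fix fix' ⟨
    a' + D a        ≤⟨ m≤m+n (a' + D a) 2 ⟩
    a' + D a + 2    ∎))
    where open ≤-Reasoning

  oasis⇒mirage : ∀ {k c₀} → 0 < k → IsOasis k b c₀ → ∃ λ d₀ → IsMirage k b d₀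
  oasis⇒mirage {k} {c₀} 0<k oasis = d₀ , mirage
    where
    a : ∀ i → i < k → ℕ
    a i i<k = proj₁ (oasis i i<k)
    a-fixed : ∀ i (i<k : i < k) → c₀ + i + D (a i i<k) ≡ a i i<k
    a-fixed i i<k = proj₂ (proj₂ (oasis i i<k))
    h : ℕ
    h = a 0 0<k / b ^ 3
    sameBlock : ∀ i (i<k : i < k) → a i i<k / b ^ 3 ≡ h
    sameBlock zero    0<k′   = cong (λ p → a 0 p / b ^ 3) (<-irrelevant 0<k′ 0<k)
    sameBlock (suc i) i+1<k = trans (sym (consecutiveFixedPoints-sameBlock (a-fixed i i<k) fix'))
                                    (sameBlock i i<k)
      where
      i<k : i < k
      i<k = <-trans (n<1+n i) i+1<k
      fix' : suc (c₀ + i) + D (a (suc i) i+1<k) ≡ a (suc i) i+1<k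
      fix' = trans (cong (_+ D (a (suc i) i+1<k)) (sym (+-suc c₀ i))) (a-fixed (suc i) i+1<k)
    open Data.Integer using (+_)
    d₀ : ℤ
    d₀ = + (c₀ + D h) ℤ.- + (h * b ^ 3)
    mirage : IsMirage k b d₀
    mirage i i<k = r , m%n<n aᵢ (b ^ 3) , [+m-+n]++i≡+r-+s (c₀ + D h) (h * b ^ 3) i r (D r) (begin
      c₀ + D h + i + D r          ≡⟨ swap c₀ (D h) i (D r) ⟩
      c₀ + i + (D r + D h)        ≡⟨ cong (λ x → c₀ + i + (D r + D x)) (sameBlock i i<k) ⟨
      c₀ + i + (D r + D hᵢ)       ≡⟨ cong (λ x → c₀ + i + x) (digitSqSum-block aᵢ) ⟨
      c₀ + i + D aᵢ               ≡⟨ a-fixed i i<k ⟩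
      aᵢ                          ≡⟨ m≡m%n+[m/n]*n aᵢ (b ^ 3) ⟩
      r + hᵢ * b ^ 3              ≡⟨ cong (λ x → r + x * b ^ 3) (sameBlock i i<k) ⟩
      r + h * b ^ 3               ≡⟨ +-comm r (h * b ^ 3) ⟩
      h * b ^ 3 + r               ∎)
      where
      open ≡-Reasoning
      aᵢ = a i i<k
      r = aᵢ % b ^ 3
      hᵢ = aᵢ / b ^ 3
      swap : ∀ c t i s → c + t + i + s ≡ c + i + (s + t)
      swap = solve-∀

theorem10 : (b k : ℕ) → .{{_ : NonZero b}} → 2 ≤ b → 1 ≤ k →
    (∃ λ c₀ → IsOasis k b c₀) → ∃ λ d₀ → IsMirage k b d₀
theorem10 b k 1<b 0<k (c₀ , oasis) = oasis⇒mirage b 1<b 0<k oasis
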